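{- Let $m\ge 2$, let $\delta_i=(\neg a_i\vee b_i)\wedge(\neg a_i\vee c_i)\wedge(\neg b_i\vee\neg c_i\vee d_i)$ for $i=1,\dots,m$, let $\gamma_m=\left(\bigvee_{i=1}^m a_i\right)\wedge\bigwedge_{i=1}^m\delta_i$, and let $\gamma''_m=\gamma_m\wedge\bigwedge_{I\in E_m}\left(\bigvee_{i\notin I}a_i\vee\bigvee_{i\in I}d_i\right)$, where $E_m$ is the family of all non-empty subsets $I\subseteq\{1,\dots,m\}$ with $|I|$ even. Then every URC-irredundant subformula of $\gamma''_m$ (i.e. every subset of the clauses of $\gamma''_m$ that is a URC formula equivalent to $\gamma''_m$ and is URC-irredundant) has size at least $2^{m-1}$.
   Context: Size is the number of clauses. A partial assignment is a set of literals with no complementary pair, identified with their conjunction; $\vdash_1$ denotes derivability by repeated unit resolution (deriving $C\setminus\{l\}$ from $C\ni l$ and $\neg l$); $\bot$ is the empty clause. A CNF $\varphi(\mathbf{z})$ is URC if for every partial assignment $\alpha$ of $\mathbf{z}$, $\varphi\wedge\alpha\models\bot$ implies $\varphi\wedge\alpha\vdash_1\bot$. A URC formula is URC-irredundant if removing any single clause either changes the represented function or yields a formula that is not URC. -}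

module Defs where

open import Data.Nat using (ℕ; zero; suc; _^_; _∸_; _≤_)
open import Data.Bool using (Bool; true; false; not; _∧_; _∨_; if_then_else_)
open import Data.Fin using (Fin)
import Data.Fin as Fin
open import Data.Fin.Subset using (Subset; ∣_∣; _-_; _∈_)
open import Data.Vec using (Vec; []; _∷_; lookup)
open import Data.List using (List; []; _∷_; [_]; _++_; map; filter; filterᵇ; concatMap; length; foldr; lookup)
open import Data.Bool.ListAction using (all; any)
import Data.List.Membership.Propositional as LM
open import Data.Product using (_×_; _,_; proj₁; proj₂; Σ)
open import Data.Sum using (_⊎_)
open import Data.Empty using (⊥)
open import Relation.Nullary using (¬_; Dec; yes; no)
open import Relation.Nullary.Decidable using (map′)
open import Relation.Binary.PropositionalEquality using (_≡_; refl; cong; _≢_)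
open import Relation.Binary.Definitions using (DecidableEquality)
import Data.Product.Properties as PP
open import Data.Fin.Properties using () renaming (_≟_ to _≟F_)

data Kind : Set where
  ka kb kc kd : Kind

_≟K_ : DecidableEquality Kind
ka ≟K ka = yes refl
ka ≟K kb = no λ ()
ka ≟K kc = no λ ()
ka ≟K kd = no λ ()
kb ≟K ka = no λ ()
kb ≟K kb = yes refl
kb ≟K kc = no λ ()
kb ≟K kd = no λ ()
kc ≟K ka = no λ ()
kc ≟K kb = no λ ()
kc ≟K kc = yes refl
kc ≟K kd = no λ ()
kd ≟K ka = no λ ()
kd ≟K kb = no λ ()
kd ≟K kc = no λ ()
kd ≟K kd = yes refl

-- variable (k , i) stands for k_{i+1}  (indices 1..m are Fin m = 0..m-1)
Var : ℕ → Set
Var m = Kind × Fin m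

_≟V_ : ∀ {m} → DecidableEquality (Var m)
_≟V_ = PP.≡-dec _≟K_ _≟F_

data Lit (m : ℕ) : Set where
  pos : Var m → Lit m
  neg : Var m → Lit m

~_ : ∀ {m} → Lit m → Lit m
~ pos x = neg x
~ neg x = pos x

_≟L_ : ∀ {m} → DecidableEquality (Lit m)
pos x ≟L pos y = map′ (cong pos) (λ { refl → refl }) (x ≟V y)
pos x ≟L neg y = no λ ()
neg x ≟L pos y = no λ ()
neg x ≟L neg y = map′ (cong neg) (λ { refl → refl }) (x ≟V y)

Clause : ℕ → Set
Clause m = List (Lit m)

CNF : ℕ → Set
CNF m = List (Clause m)

Assignment : ℕ → Set
Assignment m = Var m → Bool

evalLit : ∀ {m} → Assignment m → Lit m → Bool
evalLit τ (pos x) = τ x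
evalLit τ (neg x) = not (τ x)

evalClause : ∀ {m} → Assignment m → Clause m → Bool
evalClause τ C = any (evalLit τ) C

evalCNF : ∀ {m} → Assignment m → CNF m → Bool
evalCNF τ φ = all (evalClause τ) φ

Equivalent : ∀ {m} → CNF m → CNF m → Set
Equivalent φ ψ = ∀ τ → evalCNF τ φ ≡ evalCNF τ ψ

-- Partial assignments (sets of literals without complementary pair),
-- identified with the conjunction of their literals (unit clauses)

PartialAssignment : ∀ {m} → List (Lit m) → Set
PartialAssignment α = ∀ l → l LM.∈ α → ¬ ((~ l) LM.∈ α)

units : ∀ {m} → List (Lit m) → CNF m
units α = map [_] α

Unsat : ∀ {m} → CNF m → Set
Unsat φ = ∀ τ → evalCNF τ φ ≡ false

removeLit : ∀ {m} → Lit m → Clause m → Clause m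
removeLit l C = filter (λ x → Relation.Nullary.¬? (x ≟L l)) C

data _⊢₁_ {m : ℕ} (φ : CNF m) : Clause m → Set where
  axiom : ∀ {C} → C LM.∈ φ → φ ⊢₁ C
  unitRes : ∀ {C l} → φ ⊢₁ C → l LM.∈ C → φ ⊢₁ [ ~ l ] → φ ⊢₁ removeLit l C

URC : ∀ {m} → CNF m → Set
URC φ = ∀ (α : List (Lit _)) → PartialAssignment α →
        Unsat (φ ++ units α) → (φ ++ units α) ⊢₁ []

select : ∀ {m} (φ : CNF m) → Subset (length φ) → CNF m
select [] [] = []
select (C ∷ φ) (true ∷ S) = C ∷ select φ S
select (C ∷ φ) (false ∷ S) = select φ S

URCIrredundantSub : ∀ {m} (φ : CNF m) → Subset (length φ) → Set
URCIrredundantSub φ S =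
  URC (select φ S) ×
  (∀ j → j ∈ S → ¬ Equivalent (select φ (S - j)) (select φ S)
                 ⊎ ¬ URC (select φ (S - j)))

a b c d : ∀ {m} → Fin m → Var m
a i = ka , i
b i = kb , i
c i = kc , i
d i = kd , i

δ : ∀ {m} → Fin m → CNF m
δ i = (neg (a i) ∷ pos (b i) ∷ [])
    ∷ (neg (a i) ∷ pos (c i) ∷ [])
    ∷ (neg (b i) ∷ neg (c i) ∷ pos (d i) ∷ [])
    ∷ []

γ : (m : ℕ) → CNF m
γ m = map (λ i → pos (a i)) (Data.List.allFin m) ∷ concatMap δ (Data.List.allFin m)

allSubsets : (m : ℕ) → List (Subset m)
allSubsets zero = [] ∷ []
allSubsets (suc m) = map (true ∷_) (allSubsets m) ++ map (false ∷_) (allSubsets m)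

evenᵇ : ℕ → Bool
evenᵇ zero = true
evenᵇ (suc n) = not (evenᵇ n)

isZeroᵇ : ℕ → Bool
isZeroᵇ zero = true
isZeroᵇ (suc _) = false

E : (m : ℕ) → List (Subset m)
E m = filterᵇ (λ I → not (isZeroᵇ ∣ I ∣) ∧ evenᵇ ∣ I ∣) (allSubsets m)

clauseE : ∀ {m} → Subset m → Clause m
clauseE {m} I = map (λ i → if Data.Vec.lookup I i then pos (d i) else pos (a i)) (Data.List.allFin m)

γ'' : (m : ℕ) → CNF m
γ'' m = γ m ++ map clauseE (E m)

-- For an even set I ⊆ {1,…,m} let C_I = clauseE I = ⋁_{i∉I} aᵢ ∨ ⋁_{i∈I} dᵢ (so C_∅ = ⋁ aᵢ), and
-- let α_I be the partial assignment falsifying C_I.  Since γ''_m entails aᵢ ∧ dᵢ for some i,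
-- γ''_m ∧ α_I is unsatisfiable.  But every clause of γ''_m other than C_I keeps two literals
-- unfalsified by α_I: a δ-clause contains a negative literal and a second negative or bᵢ
-- literal, and for even J ≠ I the sets J and I differ in at least two positions, by parity.
-- So if ψ ⊆ γ''_m omits C_I, unit propagation from α_I never fires on a clause of ψ and
-- cannot refute ψ ∧ α_I.  Hence a URC subformula equivalent to γ''_m contains all 2^(m-1)
-- clauses C_I, whether or not it is irredundant.

module Submission where

open import Defs
open import Data.Nat using (ℕ; zero; suc; _≤_; _^_; _∸_)
open import Data.List using (length)
open import Data.Fin.Subset using (Subset; ∣_∣)

open import Data.Bool as Bool using (Bool; true; false; not; _∧_; _∨_; _xor_; if_then_else_; T)
open import Data.Bool.Properties
  using (∧-assoc; T-∧; T-≡; ¬-not; not-¬; not-distribˡ-xor; not-distribʳ-xor; xor-same)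
open import Data.Bool.ListAction using (all)
open import Data.Empty using (⊥; ⊥-elim)
open import Data.Fin as Fin using (Fin; zero; suc; combine; quotient; remainder)
open import Data.Fin.Properties using (combine-remQuot; injective⇒≤; 2↔Bool; suc-injective)
open import Data.Fin.Subset.Properties using (∣⊥∣≡0)
open import Data.List using (List; []; _∷_; [_]; _++_; map; allFin; lookup)
open import Data.List.Properties using (map-cong; ≡-dec)
open import Data.List.Membership.Propositional using (_∈_; _∉_)
open import Data.List.Membership.Propositional.Properties
  using (∈-map⁺; ∈-map⁻; ∈-++⁺ˡ; ∈-++⁻; ∈-filter⁺; ∈-filter⁻; ∈-allFin; ∈-concatMap⁺; ∈-concatMap⁻)
import Data.List.Membership.DecPropositional as DecMembership
open import Data.List.Relation.Binary.Subset.Propositional using (_⊆_)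
open import Data.List.Relation.Unary.Any as Any using (here; there; index; satisfied)
open import Data.List.Relation.Unary.Any.Properties as Anyₚ using (any⁻; lookup-index)
open import Data.List.Relation.Unary.All as All using (_∷_)
open import Data.List.Relation.Unary.All.Properties using (all⁺; all-anti-mono)
open import Data.Product using (_×_; _,_; proj₁; proj₂; ∃-syntax)
open import Data.Sum using (_⊎_; inj₁; inj₂)
open import Data.Unit using (⊤)
open import Data.Vec as Vec using (Vec; []; _∷_; tabulate)
open import Data.Vec.Properties
  using (tabulate∘lookup; tabulate-cong; lookup-replicate; ∷-injectiveˡ; ∷-injectiveʳ)
open import Function using (_∘_; id; Injective; Equivalence; Inverse; Injection)
open import Function.Properties.Inverse using (↔⇒↣)
open import Relation.Nullary using (¬_; Dec; yes; no; ¬?)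
open import Relation.Binary.PropositionalEquality
  using (_≡_; _≢_; refl; sym; trans; cong; cong₂; subst; module ≡-Reasoning)
open ≡-Reasoning

private
  variable
    m n : ℕ
    A : Set

all-++ : (p : A → Bool) (xs ys : List A) → all p (xs ++ ys) ≡ all p xs ∧ all p ys
all-++ p []       ys = refl
all-++ p (x ∷ xs) ys = trans (cong (p x ∧_) (all-++ p xs ys)) (sym (∧-assoc (p x) _ _))

¬T⇒≡false : ∀ {b} → ¬ T b → b ≡ false
¬T⇒≡false ¬b = ¬-not (¬b ∘ Equivalence.from T-≡)

Equivalent⇒Unsat-++ : {ψ φ β : CNF m} → Equivalent ψ φ → Unsat (φ ++ β) → Unsat (ψ ++ β)
Equivalent⇒Unsat-++ {ψ = ψ} {φ} {β} ψ≡φ φβ-unsat τ = begin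
  evalCNF τ (ψ ++ β)         ≡⟨ all-++ (evalClause τ) ψ β ⟩
  evalCNF τ ψ ∧ evalCNF τ β  ≡⟨ cong (_∧ evalCNF τ β) (ψ≡φ τ) ⟩
  evalCNF τ φ ∧ evalCNF τ β  ≡⟨ all-++ (evalClause τ) φ β ⟨
  evalCNF τ (φ ++ β)         ≡⟨ φβ-unsat τ ⟩
  false                      ∎

~-involutive : (l : Lit m) → ~ (~ l) ≡ l
~-involutive (pos x) = refl
~-involutive (neg x) = refl

~-injective : {l l′ : Lit m} → ~ l ≡ ~ l′ → l ≡ l′
~-injective {l = l} {l′} e = begin
  l        ≡⟨ ~-involutive l ⟨
  ~ (~ l)  ≡⟨ cong ~_ e ⟩
  ~ (~ l′) ≡⟨ ~-involutive l′ ⟩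
  l′       ∎

falsifier : Clause m → List (Lit m)
falsifier C = map ~_ C

~∈falsifier⇒∈ : {C : Clause m} {z : Lit m} → ~ z ∈ falsifier C → z ∈ C
~∈falsifier⇒∈ {C = C} ~z∈ with ∈-map⁻ ~_ ~z∈
... | y , y∈C , ~z≡~y = subst (_∈ C) (sym (~-injective ~z≡~y)) y∈C

-- D is falsified by α, or becomes the unit clause u under α.
FalsifiedExcept : List (Lit m) → Lit m → Clause m → Set
FalsifiedExcept α u D = ∀ {z} → z ∈ D → z ≢ u → ~ z ∈ α

twoUnfalsified⇒¬FalsifiedExcept : {C D : Clause m} {x y u : Lit m} →
  x ∈ D → y ∈ D → x ≢ y → x ∉ C → y ∉ C → ¬ FalsifiedExcept (falsifier C) u D
twoUnfalsified⇒¬FalsifiedExcept {x = x} {u = u} x∈D y∈D x≢y x∉C y∉C falsified with x ≟L u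
... | yes refl = y∉C (~∈falsifier⇒∈ (falsified y∈D (x≢y ∘ sym)))
... | no x≢u   = x∉C (~∈falsifier⇒∈ (falsified x∈D x≢u))

module _ {φ : CNF m} {α : List (Lit m)}
         (noUnit : ∀ {D u} → D ∈ φ → u ∈ D → ¬ FalsifiedExcept α u D) where

  unit⇒∈α : ∀ {D u} → D ∈ φ ++ units α → u ∈ D → FalsifiedExcept α u D → u ∈ α
  unit⇒∈α D∈ u∈D falsified with ∈-++⁻ φ D∈
  ... | inj₁ D∈φ = ⊥-elim (noUnit D∈φ u∈D falsified)
  ... | inj₂ D∈α with ∈-map⁻ [_] D∈α
  ... | l , l∈α , refl with u∈D
  ... | here refl = l∈α

  -- Every unit clause [~ l] derived here stems from a unit clause of α, so each
  -- resolution step removes a literal falsified by α.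
  ⊢₁⇒falsifiedExtension : ∀ {C} → (φ ++ units α) ⊢₁ C →
    ∃[ D ] D ∈ φ ++ units α × C ⊆ D × (∀ {z} → z ∈ D → z ∉ C → ~ z ∈ α)
  ⊢₁⇒falsifiedExtension (axiom C∈) = _ , C∈ , id , λ z∈C z∉C → ⊥-elim (z∉C z∈C)
  ⊢₁⇒falsifiedExtension (unitRes {C} {l} ⊢C l∈C ⊢~l)
    with ⊢₁⇒falsifiedExtension ⊢C | ⊢₁⇒falsifiedExtension ⊢~l
  ... | D , D∈ , C⊆D , D∖C-falsified | D′ , D′∈ , ~l⊆D′ , D′∖~l-falsified =
    D , D∈ , C⊆D ∘ proj₁ ∘ ∈-filter⁻ P? , falsified
    where
    P? : ∀ x → Dec (x ≢ l)
    P? x = ¬? (x ≟L l)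

    ~l∈α : ~ l ∈ α
    ~l∈α = unit⇒∈α D′∈ (~l⊆D′ (here refl))
             (λ z∈D′ z≢~l → D′∖~l-falsified z∈D′ λ { (here z≡~l) → z≢~l z≡~l ; (there ()) })

    falsified : ∀ {z} → z ∈ D → z ∉ removeLit l C → ~ z ∈ α
    falsified {z} z∈D z∉C∖l with z ≟L l
    ... | yes refl = ~l∈α
    ... | no z≢l   = D∖C-falsified z∈D (λ z∈C → z∉C∖l (∈-filter⁺ P? z∈C z≢l))

  ⊢₁⊥⇒falsifiedClause : PartialAssignment α → (φ ++ units α) ⊢₁ [] →
    ∃[ D ] D ∈ φ × (∀ {z} → z ∈ D → ~ z ∈ α)
  ⊢₁⊥⇒falsifiedClause consistent ⊢⊥ with ⊢₁⇒falsifiedExtension ⊢⊥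
  ... | D , D∈ , _ , falsified with ∈-++⁻ φ D∈
  ... | inj₁ D∈φ = D , D∈φ , λ z∈D → falsified z∈D λ ()
  ... | inj₂ D∈α with ∈-map⁻ [_] D∈α
  ... | l , l∈α , refl = ⊥-elim (consistent l l∈α (falsified (here refl) λ ()))

lookup-injective : {I J : Vec A n} → (∀ i → Vec.lookup I i ≡ Vec.lookup J i) → I ≡ J
lookup-injective {I = I} {J} I≗J = begin
  I                        ≡⟨ tabulate∘lookup I ⟨
  tabulate (Vec.lookup I)  ≡⟨ tabulate-cong I≗J ⟩
  tabulate (Vec.lookup J)  ≡⟨ tabulate∘lookup J ⟩
  J                        ∎

evenᵇ-∣∷∣ : ∀ x (K : Subset n) → evenᵇ ∣ x ∷ K ∣ ≡ x xor evenᵇ ∣ K ∣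
evenᵇ-∣∷∣ true  K = refl
evenᵇ-∣∷∣ false K = refl

evenᵇ-flip : {I J : Subset n} (j : Fin n) →
  (∀ i → i ≢ j → Vec.lookup J i ≡ Vec.lookup I i) → Vec.lookup J j ≢ Vec.lookup I j →
  evenᵇ ∣ J ∣ ≡ not (evenᵇ ∣ I ∣)
evenᵇ-flip {I = y ∷ I} {x ∷ J} zero agree x≢y = begin
  evenᵇ ∣ x ∷ J ∣           ≡⟨ evenᵇ-∣∷∣ x J ⟩
  x xor evenᵇ ∣ J ∣         ≡⟨ cong₂ _xor_ (¬-not x≢y) (cong (evenᵇ ∘ ∣_∣) J≡I) ⟩
  not y xor evenᵇ ∣ I ∣     ≡⟨ not-distribˡ-xor y _ ⟨
  not (y xor evenᵇ ∣ I ∣)   ≡⟨ cong not (evenᵇ-∣∷∣ y I) ⟨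
  not (evenᵇ ∣ y ∷ I ∣)     ∎
  where
  J≡I : J ≡ I
  J≡I = lookup-injective (λ i → agree (suc i) λ ())
evenᵇ-flip {I = y ∷ I} {x ∷ J} (suc j) agree differ = begin
  evenᵇ ∣ x ∷ J ∣           ≡⟨ evenᵇ-∣∷∣ x J ⟩
  x xor evenᵇ ∣ J ∣         ≡⟨ cong₂ _xor_ (agree zero λ ()) J-flips-I ⟩
  y xor not (evenᵇ ∣ I ∣)   ≡⟨ not-distribʳ-xor y _ ⟨
  not (y xor evenᵇ ∣ I ∣)   ≡⟨ cong not (evenᵇ-∣∷∣ y I) ⟨
  not (evenᵇ ∣ y ∷ I ∣)     ∎
  where
  J-flips-I : evenᵇ ∣ J ∣ ≡ not (evenᵇ ∣ I ∣)
  J-flips-I = evenᵇ-flip {I = I} {J} j (λ i i≢j → agree (suc i) (i≢j ∘ suc-injective)) differ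

sameParity-agreeExcept⇒≡ : {I J : Subset n} → evenᵇ ∣ J ∣ ≡ evenᵇ ∣ I ∣ → (j : Fin n) →
  (∀ i → i ≢ j → Vec.lookup J i ≡ Vec.lookup I i) → J ≡ I
sameParity-agreeExcept⇒≡ {I = I} {J} sameParity j agree with Vec.lookup J j Bool.≟ Vec.lookup I j
... | no differ  = ⊥-elim (not-¬ sameParity (evenᵇ-flip {I = I} {J} j agree differ))
... | yes same = lookup-injective agreeEverywhere
  where
  agreeEverywhere : ∀ i → Vec.lookup J i ≡ Vec.lookup I i
  agreeEverywhere i with i Fin.≟ j
  ... | yes refl = same
  ... | no i≢j   = agree i i≢j

evenExtension : Subset n → Subset (suc n)
evenExtension J = not (evenᵇ ∣ J ∣) ∷ J

evenExtension-even : (J : Subset n) → evenᵇ ∣ evenExtension J ∣ ≡ true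
evenExtension-even J = begin
  evenᵇ ∣ evenExtension J ∣  ≡⟨ evenᵇ-∣∷∣ (not e) J ⟩
  not e xor e                ≡⟨ not-distribˡ-xor e e ⟨
  not (e xor e)              ≡⟨ cong not (xor-same e) ⟩
  true                       ∎
  where
  e : Bool
  e = evenᵇ ∣ J ∣

binaryDigits : ∀ n → Fin (2 ^ n) → Subset n
binaryDigits zero    _ = []
binaryDigits (suc n) k =
  Inverse.to 2↔Bool (quotient (2 ^ n) k) ∷ binaryDigits n (remainder {2} (2 ^ n) k)

binaryDigits-injective : ∀ n → Injective _≡_ _≡_ (binaryDigits n)
binaryDigits-injective zero    {zero} {zero} _ = refl
binaryDigits-injective (suc n) {k} {k′} digits≡ = begin
  k                                                          ≡⟨ combine-remQuot {2} (2 ^ n) k ⟨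
  combine (quotient (2 ^ n) k) (remainder {2} (2 ^ n) k)     ≡⟨ cong₂ combine quotient≡ remainder≡ ⟩
  combine (quotient (2 ^ n) k′) (remainder {2} (2 ^ n) k′)   ≡⟨ combine-remQuot {2} (2 ^ n) k′ ⟩
  k′                                                         ∎
  where
  quotient≡ : quotient (2 ^ n) k ≡ quotient (2 ^ n) k′
  quotient≡ = Injection.injective (↔⇒↣ 2↔Bool) (∷-injectiveˡ digits≡)
  remainder≡ : remainder {2} (2 ^ n) k ≡ remainder {2} (2 ^ n) k′
  remainder≡ = binaryDigits-injective n (∷-injectiveʳ digits≡)

injective-∈⇒≤-length : ∀ {k} {xs : List A} {f : Fin k → A} →
  Injective _≡_ _≡_ f → (∀ i → f i ∈ xs) → k ≤ length xs
injective-∈⇒≤-length {xs = xs} {f} f-injective f∈xs = injective⇒≤ position-injective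
  where
  position-injective : Injective _≡_ _≡_ (index ∘ f∈xs)
  position-injective {i} {j} positions≡ = f-injective (begin
    f i                        ≡⟨ lookup-index (f∈xs i) ⟩
    lookup xs (index (f∈xs i)) ≡⟨ cong (lookup xs) positions≡ ⟩
    lookup xs (index (f∈xs j)) ≡⟨ lookup-index (f∈xs j) ⟨
    f j                        ∎)

select-⊆ : (φ : CNF m) (S : Subset (length φ)) → select φ S ⊆ φ
select-⊆ []      []          ()
select-⊆ (C ∷ φ) (true  ∷ S) (here C≡)  = here C≡
select-⊆ (C ∷ φ) (true  ∷ S) (there C∈) = there (select-⊆ φ S C∈)
select-⊆ (C ∷ φ) (false ∷ S) C∈         = there (select-⊆ φ S C∈)

length-select : (φ : CNF m) (S : Subset (length φ)) → length (select φ S) ≡ ∣ S ∣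
length-select []      []          = refl
length-select (C ∷ φ) (true  ∷ S) = cong suc (length-select φ S)
length-select (C ∷ φ) (false ∷ S) = length-select φ S

litE : Subset m → Fin m → Lit m
litE I i = if Vec.lookup I i then pos (d i) else pos (a i)

litE∈clauseE : (I : Subset m) (i : Fin m) → litE I i ∈ clauseE I
litE∈clauseE I i = ∈-map⁺ (litE I) (∈-allFin i)

if-d-a-injective : ∀ {x y} {i j : Fin m} →
  (if x then pos (d i) else pos (a i)) ≡ (if y then pos (d j) else pos (a j)) → x ≡ y × i ≡ j
if-d-a-injective {x = true}  {true}  refl = refl , refl
if-d-a-injective {x = false} {false} refl = refl , refl
if-d-a-injective {x = true}  {false} ()
if-d-a-injective {x = false} {true}  ()

∈clauseE⇒agree : {I J : Subset m} {i : Fin m} →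
  litE J i ∈ clauseE I → Vec.lookup J i ≡ Vec.lookup I i
∈clauseE⇒agree {I = I} litE∈ with ∈-map⁻ (litE I) litE∈
... | _ , _ , litE≡ with if-d-a-injective litE≡
... | lookup≡ , refl = lookup≡

clauseE-injective : {I J : Subset m} → clauseE I ≡ clauseE J → I ≡ J
clauseE-injective {I = I} {J} clauseE≡ =
  lookup-injective λ i →
    ∈clauseE⇒agree {I = J} {I} (subst (litE I i ∈_) clauseE≡ (litE∈clauseE I i))

varIndex : Lit m → Fin m
varIndex (pos (_ , i)) = i
varIndex (neg (_ , i)) = i

varIndex-litE : (I : Subset m) (i : Fin m) → varIndex (litE I i) ≡ i
varIndex-litE I i with Vec.lookup I i
... | true  = refl
... | false = refl

IsPositiveAOrD : Lit m → Set
IsPositiveAOrD (pos (ka , _)) = ⊤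
IsPositiveAOrD (pos (kd , _)) = ⊤
IsPositiveAOrD _              = ⊥

IsPositiveAOrD-~ : (l : Lit m) → IsPositiveAOrD l → ¬ IsPositiveAOrD (~ l)
IsPositiveAOrD-~ (pos _) _ ()

∈clauseE⇒IsPositiveAOrD : (I : Subset m) {z : Lit m} → z ∈ clauseE I → IsPositiveAOrD z
∈clauseE⇒IsPositiveAOrD I z∈ with ∈-map⁻ (litE I) z∈
... | i , _ , refl with Vec.lookup I i
...   | true  = _
...   | false = _

∈E⇒even : {J : Subset m} → J ∈ E m → evenᵇ ∣ J ∣ ≡ true
∈E⇒even {m = m} {J} J∈E = Equivalence.to T-≡ (proj₂ (Equivalence.to T-∧ nonemptyEven))
  where
  nonemptyEven : T (not (isZeroᵇ ∣ J ∣) ∧ evenᵇ ∣ J ∣)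
  nonemptyEven = proj₂ (∈-filter⁻ (λ I → Bool.T? (not (isZeroᵇ ∣ I ∣) ∧ evenᵇ ∣ I ∣))
                                  {xs = allSubsets m} J∈E)

δ⊆γ'' : (i : Fin m) → δ i ⊆ γ'' m
δ⊆γ'' i D∈δ = ∈-++⁺ˡ (there (∈-concatMap⁺ δ (Any.map (λ { refl → D∈δ }) (∈-allFin i))))

-- The clause ⋁ aᵢ of γ is clauseE ∅.
∈γ''⁻ : {D : Clause m} → D ∈ γ'' m →
  (∃[ i ] D ∈ δ i) ⊎ (∃[ J ] evenᵇ ∣ J ∣ ≡ true × D ≡ clauseE J)
∈γ''⁻ {m = m} D∈ with ∈-++⁻ (γ m) D∈
... | inj₁ (here refl) = inj₂ (Vec.replicate m false , cong evenᵇ (∣⊥∣≡0 m) , clauseE-∅)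
  where
  clauseE-∅ : map (λ i → pos (a i)) (allFin m) ≡ clauseE (Vec.replicate m false)
  clauseE-∅ = sym (map-cong
    (λ i → cong (if_then pos (d i) else pos (a i)) (lookup-replicate i false)) (allFin m))
... | inj₁ (there D∈δ) = inj₁ (satisfied (∈-concatMap⁻ δ {xs = allFin m} D∈δ))
... | inj₂ D∈E with ∈-map⁻ clauseE D∈E
... | J , J∈E , refl = inj₂ (J , ∈E⇒even J∈E , refl)

δ⇒a→d : (τ : Assignment m) (i : Fin m) → T (evalCNF τ (δ i)) → T (τ (a i)) → T (τ (d i))
δ⇒a→d τ i = clauses (τ (a i)) (τ (b i)) (τ (c i)) (τ (d i))
  where
  clauses : ∀ x y z w →
    T ((not x ∨ (y ∨ false)) ∧ ((not x ∨ (z ∨ false)) ∧ ((not y ∨ (not z ∨ (w ∨ false))) ∧ true))) →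
    T x → T w
  clauses true  true  true  true  _  _ = _
  clauses true  false _     _     () _
  clauses true  true  false _     () _
  clauses true  true  true  false () _
  clauses false _     _     _     _  ()

γ''⇒a∧d : (τ : Assignment m) → T (evalCNF τ (γ'' m)) → ∃[ i ] T (τ (a i)) × T (τ (d i))
γ''⇒a∧d τ γ''-holds with all⁺ (evalClause τ) (γ'' _) γ''-holds
... | someA ∷ _
    with satisfied (Anyₚ.map⁻ {f = λ i → pos (a i)} {xs = allFin _} (any⁻ (evalLit τ) _ someA))
... | i , aᵢ = i , aᵢ , δ⇒a→d τ i (all-anti-mono (evalClause τ) (δ⊆γ'' i) γ''-holds) aᵢ

falsifierE-consistent : (I : Subset m) → PartialAssignment (falsifier (clauseE I))
falsifierE-consistent I l l∈ ~l∈ with ∈-map⁻ ~_ l∈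
... | y , y∈ , refl = IsPositiveAOrD-~ y (∈clauseE⇒IsPositiveAOrD I y∈)
                        (∈clauseE⇒IsPositiveAOrD I (~∈falsifier⇒∈ ~l∈))

γ''∧falsifierE-unsat : (I : Subset m) → Unsat (γ'' m ++ units (falsifier (clauseE I)))
γ''∧falsifierE-unsat {m = m} I τ = ¬T⇒≡false λ holds →
  let γ''-holds , α-holds =
        Equivalence.to T-∧ (subst T (all-++ (evalClause τ) (γ'' m) (units α)) holds)
      i , aᵢ , dᵢ = γ''⇒a∧d τ γ''-holds
      unit-holds = All.lookup (all⁺ (evalClause τ) (units α) α-holds)
                     (∈-map⁺ [_] (∈-map⁺ ~_ (litE∈clauseE I i)))
  in falsifiedByUnit (Vec.lookup I i) unit-holds aᵢ dᵢ
  where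
  α = falsifier (clauseE I)
  notAndFalse : ∀ v → T (not v ∨ false) → ¬ T v
  notAndFalse true  ()
  notAndFalse false _ ()
  falsifiedByUnit : ∀ {i} x → T (evalClause τ [ ~ (if x then pos (d i) else pos (a i)) ]) →
    T (τ (a i)) → ¬ T (τ (d i))
  falsifiedByUnit {i} true  unit _  = notAndFalse (τ (d i)) unit
  falsifiedByUnit {i} false unit aᵢ = ⊥-elim (notAndFalse (τ (a i)) unit aᵢ)

firstTwoUnfalsified : (I : Subset m) {x y : Lit m} {D : Clause m} {u : Lit m} →
  x ≢ y → ¬ IsPositiveAOrD x → ¬ IsPositiveAOrD y →
  ¬ FalsifiedExcept (falsifier (clauseE I)) u (x ∷ y ∷ D)
firstTwoUnfalsified I x≢y x-not y-not =
  twoUnfalsified⇒¬FalsifiedExcept (here refl) (there (here refl)) x≢y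
  (x-not ∘ ∈clauseE⇒IsPositiveAOrD I) (y-not ∘ ∈clauseE⇒IsPositiveAOrD I)

δ-untriggered : (I : Subset m) (i : Fin m) {D : Clause m} {u : Lit m} →
  D ∈ δ i → ¬ FalsifiedExcept (falsifier (clauseE I)) u D
δ-untriggered I i (here refl)                 = firstTwoUnfalsified I (λ ()) id id
δ-untriggered I i (there (here refl))         = firstTwoUnfalsified I (λ ()) id id
δ-untriggered I i (there (there (here refl))) = firstTwoUnfalsified I (λ ()) id id

falsifiedExcept⇒≡clauseE : {I : Subset m} → evenᵇ ∣ I ∣ ≡ true → {D : Clause m} {u : Lit m} →
  D ∈ γ'' m → FalsifiedExcept (falsifier (clauseE I)) u D → D ≡ clauseE I
falsifiedExcept⇒≡clauseE {I = I} I-even {u = u} D∈ falsified with ∈γ''⁻ D∈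
... | inj₁ (i , D∈δ) = ⊥-elim (δ-untriggered I i D∈δ falsified)
... | inj₂ (J , J-even , refl) =
  cong clauseE (sameParity-agreeExcept⇒≡ {I = I} {J} (trans J-even (sym I-even)) (varIndex u) agree)
  where
  agree : ∀ i → i ≢ varIndex u → Vec.lookup J i ≡ Vec.lookup I i
  agree i i≢u = ∈clauseE⇒agree {I = I} {J} (~∈falsifier⇒∈ (falsified (litE∈clauseE J i) litE≢u))
    where
    litE≢u : litE J i ≢ u
    litE≢u litE≡u = i≢u (trans (sym (varIndex-litE J i)) (cong varIndex litE≡u))

clauseE∉⇒¬⊢₁⊥ : {ψ : CNF (suc n)} {I : Subset (suc n)} →
  ψ ⊆ γ'' (suc n) → evenᵇ ∣ I ∣ ≡ true → clauseE I ∉ ψ →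
  ¬ ((ψ ++ units (falsifier (clauseE I))) ⊢₁ [])
clauseE∉⇒¬⊢₁⊥ {ψ = ψ} {I} ψ⊆γ'' I-even I∉ψ refutation =
  let D , D∈ψ , falsified = ⊢₁⊥⇒falsifiedClause (λ D∈ψ _ → untriggered D∈ψ)
                              (falsifierE-consistent I) refutation
  -- A clause falsified by α is in particular falsified except at a₀.
  in untriggered D∈ψ {u = pos (a zero)} (λ z∈D _ → falsified z∈D)
  where
  untriggered : ∀ {D} → D ∈ ψ → ∀ {u} → ¬ FalsifiedExcept (falsifier (clauseE I)) u D
  untriggered D∈ψ falsified =
    I∉ψ (subst (_∈ ψ) (falsifiedExcept⇒≡clauseE {I = I} I-even (ψ⊆γ'' D∈ψ) falsified) D∈ψ)

URC-equivalent⇒clauseE∈ : {ψ : CNF (suc n)} →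
  ψ ⊆ γ'' (suc n) → Equivalent ψ (γ'' (suc n)) → URC ψ →
  {I : Subset (suc n)} → evenᵇ ∣ I ∣ ≡ true → clauseE I ∈ ψ
URC-equivalent⇒clauseE∈ {n = n} {ψ = ψ} ψ⊆γ'' ψ≡γ'' ψ-URC {I} I-even
  with DecMembership._∈?_ (≡-dec _≟L_) (clauseE I) ψ
... | yes I∈ψ = I∈ψ
... | no  I∉ψ = ⊥-elim (clauseE∉⇒¬⊢₁⊥ {I = I} ψ⊆γ'' I-even I∉ψ refutation)
  where
  ψ∧α-unsat : Unsat (ψ ++ units (falsifier (clauseE I)))
  ψ∧α-unsat = Equivalent⇒Unsat-++ {ψ = ψ} {γ'' (suc n)} ψ≡γ'' (γ''∧falsifierE-unsat I)
  refutation : (ψ ++ units (falsifier (clauseE I))) ⊢₁ []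
  refutation = ψ-URC _ (falsifierE-consistent I) ψ∧α-unsat

lemma7 : (m : ℕ) → 2 ≤ m → (S : Subset (length (γ'' m))) →
         Equivalent (select (γ'' m) S) (γ'' m) →
         URCIrredundantSub (γ'' m) S →
         2 ^ (m ∸ 1) ≤ ∣ S ∣
lemma7 zero    ()
lemma7 (suc n) _ S ψ≡γ'' (ψ-URC , _) =
  subst (2 ^ n ≤_) (length-select (γ'' (suc n)) S)
    (injective-∈⇒≤-length evenClause-injective λ k →
      URC-equivalent⇒clauseE∈ (select-⊆ _ S) ψ≡γ'' ψ-URC {evenClauseSet k}
        (evenExtension-even (binaryDigits n k)))
  where
  evenClauseSet : Fin (2 ^ n) → Subset (suc n)
  evenClauseSet = evenExtension ∘ binaryDigits n

  evenClause : Fin (2 ^ n) → Clause (suc n)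
  evenClause = clauseE ∘ evenClauseSet

  evenClause-injective : Injective _≡_ _≡_ evenClause
  evenClause-injective = binaryDigits-injective n ∘ ∷-injectiveʳ ∘ clauseE-injective
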